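{- Let $d$ be a positive integer and $0\le k\le n$ integers. Then $$\left\langle \begin{matrix} n\\ k\end{matrix}\right\rangle_d=\det\left(\binom{n+i+j}{k+j}\right)_{i,j=0}^{d-1}=\det\left(\binom{n}{k+i-j}\right)_{i,j=0}^{d-1}.$$
   Context: For a positive integer $d$ and integer $m\ge0$, $\langle m\rangle_d=\binom{m+d-1}{d}$. For $0\le k\le n$, $\left\langle \begin{matrix} n\\ k\end{matrix}\right\rangle_d=\prod_{j=0}^{k-1}\frac{\langle n-j\rangle_d}{\langle k-j\rangle_d}$. Binomial coefficients $\binom{n}{m}$ with $m<0$ or $m>n$ are $0$. -}

module Defs where

open import Data.Nat as ℕ using (ℕ; zero; suc; _∸_)
open import Data.Nat.Combinatorics using (_C_)
open import Data.Fin using (Fin; zero; suc; toℕ; punchIn)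
open import Data.Integer as ℤ using (ℤ; +_)
open import Data.Rational as ℚ using (ℚ)

-- ⟨ m ⟩_d = binom(m+d-1, d)   (natural subtraction; only used for d ≥ 1)
angle : ℕ → ℕ → ℕ
angle d m = (m ℕ.+ d ∸ 1) C d

-- a / b as a rational number; b = 0 is sent to 0 (never used with b = 0 below)
frac : ℕ → ℕ → ℚ
frac a zero    = ℚ.0ℚ
frac a (suc b) = (+ a) ℚ./ suc b

prodℚ : ℕ → (ℕ → ℚ) → ℚ
prodℚ zero    f = ℚ.1ℚ
prodℚ (suc k) f = prodℚ k f ℚ.* f k

gbinom : ℕ → ℕ → ℕ → ℚ
gbinom d n k = prodℚ k (λ j → frac (angle d (n ∸ j)) (angle d (k ∸ j)))

binomℤ : ℕ → ℤ → ℤ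
binomℤ n (+ m)       = + (n C m)
binomℤ n ℤ.-[1+ m ]  = + 0

sumFin : ∀ n → (Fin n → ℤ) → ℤ
sumFin zero    f = + 0
sumFin (suc n) f = f zero ℤ.+ sumFin n (λ i → f (suc i))

sign : ℕ → ℤ
sign zero          = + 1
sign (suc zero)    = ℤ.- (+ 1)
sign (suc (suc j)) = sign j

det : ∀ n → (Fin n → Fin n → ℤ) → ℤ
det zero    M = + 1
det (suc n) M = sumFin (suc n) λ j →
  sign (toℕ j) ℤ.* M zero j ℤ.* det n (λ i l → M (suc i) (punchIn j l))

-- Let D k be the determinant of binom(n + i + j, k + i), the transpose of the first matrix.
-- Pascal's rule turns the Toeplitz matrix binom(n, k + i − j) into it by adding each row (and then
-- each column) to the next, so the second determinant is D k, and D 0 = 1 since binom(n, i − j) is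
-- unitriangular. Absorption, (k + 1 + i) binom(N, k + 1 + i) = (n − k + j) binom(N, k + i) for
-- N = n + i + j, says that scaling the rows of the matrix of D (k + 1) and the columns of that of
-- D k gives the same matrix; with the rising factorials (m)(m + 1)⋯(m + d − 1) = d! ⟨m⟩_d this is
-- ⟨k + 1⟩_d D (k + 1) = ⟨n − k⟩_d D k, so D k is the generalized binomial coefficient. Finally
-- binom(n + i + j, k + j) = binom(n + i + j, n − k + i) turns the first determinant into D (n − k),
-- and D (n − k) = D k because both are determined by the same products of ⟨·⟩_d.

module Submission where

open import Defs
open import Data.Nat using (ℕ; _≤_)
open import Data.Fin using (toℕ)
open import Data.Integer using (+_; _+_; _-_)
open import Data.Rational using (_/_)
open import Data.Product using (_×_)
open import Relation.Binary.PropositionalEquality using (_≡_)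

open import Data.Nat as ℕ using (zero; suc; z≤n; s≤s; _<_; _∸_; _⊓_; _!)
import Data.Nat.Properties as ℕₚ
open import Data.Nat.Combinatorics using (_C_; nCk+nC[k+1]≡[n+1]C[k+1]; nC1≡n; nCk≡nC[n∸k])
open import Data.Nat.Combinatorics.Specification using (k>n⇒nCk≡0)
import Data.Nat.Tactic.RingSolver as ℕ-Solver
open import Data.Integer using (ℤ; -[1+_]; _*_; -_)
import Data.Integer.Properties as ℤₚ
open import Data.Integer.Tactic.RingSolver using (solve-∀)
open import Data.Fin as Fin using (Fin; punchIn)
import Data.Rational as ℚ
import Data.Rational.Properties as ℚₚ
import Data.Rational.Unnormalised as ℚᵘ
import Data.Rational.Unnormalised.Properties as ℚᵘₚ
open import Data.Empty using (⊥-elim)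
open import Data.Sum using (_⊎_; inj₁; inj₂)
open import Data.Product using (_,_)
open import Function using (_∘_)
open import Relation.Nullary using (yes; no)
open import Relation.Binary.PropositionalEquality
  using (refl; sym; trans; cong; cong₂; subst; _≢_; module ≡-Reasoning)

punchInℕ : ℕ → ℕ → ℕ
punchInℕ zero    j       = suc j
punchInℕ (suc i) zero    = zero
punchInℕ (suc i) (suc j) = suc (punchInℕ i j)

-- punchOutℕ i i is a junk value; every lemma about punchOutℕ i j assumes i ≢ j.
punchOutℕ : ℕ → ℕ → ℕ
punchOutℕ zero    zero    = zero
punchOutℕ zero    (suc j) = j
punchOutℕ (suc i) zero    = zero
punchOutℕ (suc i) (suc j) = suc (punchOutℕ i j)

punchOutℕ-punchInℕ : ∀ i j → punchOutℕ i (punchInℕ i j) ≡ j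
punchOutℕ-punchInℕ zero    j       = refl
punchOutℕ-punchInℕ (suc i) zero    = refl
punchOutℕ-punchInℕ (suc i) (suc j) = cong suc (punchOutℕ-punchInℕ i j)

punchInℕ-punchOutℕ : ∀ {i j} → i ≢ j → punchInℕ i (punchOutℕ i j) ≡ j
punchInℕ-punchOutℕ {zero}  {zero}  i≢j = ⊥-elim (i≢j refl)
punchInℕ-punchOutℕ {zero}  {suc j} i≢j = refl
punchInℕ-punchOutℕ {suc i} {zero}  i≢j = refl
punchInℕ-punchOutℕ {suc i} {suc j} i≢j = cong suc (punchInℕ-punchOutℕ (i≢j ∘ cong suc))

punchInℕᵢ≢i : ∀ i j → punchInℕ i j ≢ i
punchInℕᵢ≢i zero    j       ()
punchInℕᵢ≢i (suc i) zero    ()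
punchInℕᵢ≢i (suc i) (suc j) = punchInℕᵢ≢i i j ∘ ℕₚ.suc-injective

punchInℕ≡⇒≡punchOutℕ : ∀ {i j l} → punchInℕ i j ≡ l → j ≡ punchOutℕ i l
punchInℕ≡⇒≡punchOutℕ {i} {j} e = trans (sym (punchOutℕ-punchInℕ i j)) (cong (punchOutℕ i) e)

-- Deleting columns i and j of a matrix in either order gives the same result.
punchInℕ-commute : ∀ {i j} → i ≢ j → ∀ l →
  punchInℕ i (punchInℕ (punchOutℕ i j) l) ≡ punchInℕ j (punchInℕ (punchOutℕ j i) l)
punchInℕ-commute {zero}  {zero}  i≢j l       = ⊥-elim (i≢j refl)
punchInℕ-commute {zero}  {suc j} i≢j l       = refl
punchInℕ-commute {suc i} {zero}  i≢j l       = refl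
punchInℕ-commute {suc i} {suc j} i≢j zero    = refl
punchInℕ-commute {suc i} {suc j} i≢j (suc l) = cong suc (punchInℕ-commute (i≢j ∘ cong suc) l)

punchInℕ≤suc : ∀ i j → punchInℕ i j ≤ suc j
punchInℕ≤suc zero    j       = ℕₚ.≤-refl
punchInℕ≤suc (suc i) zero    = z≤n
punchInℕ≤suc (suc i) (suc j) = s≤s (punchInℕ≤suc i j)

punchInℕ-< : ∀ {n} i {j} → j < n → punchInℕ i j < suc n
punchInℕ-< i {j} j<n = s≤s (ℕₚ.≤-trans (punchInℕ≤suc i j) j<n)

punchOutℕ-< : ∀ {n i j} → i < suc n → j < suc n → i ≢ j → punchOutℕ i j < n
punchOutℕ-< {n}     {zero}  {zero}  _         _         i≢j = ⊥-elim (i≢j refl)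
punchOutℕ-< {n}     {zero}  {suc j} _         (s≤s j<n) _   = j<n
punchOutℕ-< {zero}  {suc i} {_}     (s≤s ())  _         _
punchOutℕ-< {suc n} {suc i} {zero}  _         _         _   = s≤s z≤n
punchOutℕ-< {suc n} {suc i} {suc j} (s≤s i<) (s≤s j<) i≢j =
  s≤s (punchOutℕ-< i< j< (i≢j ∘ cong suc))

punchOutℕ-suc : ∀ {i j} → i ≢ j → i ≢ suc j → punchOutℕ i (suc j) ≡ suc (punchOutℕ i j)
punchOutℕ-suc {zero}        {zero}  i≢j _    = ⊥-elim (i≢j refl)
punchOutℕ-suc {zero}        {suc j} _   _    = refl
punchOutℕ-suc {suc zero}    {zero}  _   i≢1  = ⊥-elim (i≢1 refl)
punchOutℕ-suc {suc (suc i)} {zero}  _   _    = refl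
punchOutℕ-suc {suc i}       {suc j} i≢j i≢j+1 =
  cong suc (punchOutℕ-suc (i≢j ∘ cong suc) (i≢j+1 ∘ cong suc))

punchInℕ-adjacent : ∀ c l →
  punchInℕ c l ≡ punchInℕ (suc c) l ⊎ (punchInℕ c l ≡ suc c × punchInℕ (suc c) l ≡ c)
punchInℕ-adjacent zero    zero    = inj₂ (refl , refl)
punchInℕ-adjacent zero    (suc l) = inj₁ refl
punchInℕ-adjacent (suc c) zero    = inj₁ refl
punchInℕ-adjacent (suc c) (suc l) with punchInℕ-adjacent c l
... | inj₁ e          = inj₁ (cong suc e)
... | inj₂ (e₁ , e₂) = inj₂ (cong suc e₁ , cong suc e₂)

sign-suc : ∀ n → sign (suc n) ≡ - sign n
sign-suc zero          = refl
sign-suc (suc zero)    = refl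
sign-suc (suc (suc n)) = sign-suc n

sign-punchOutℕ-antisym : ∀ {i j} → i ≢ j →
  sign i * sign (punchOutℕ i j) ≡ - (sign j * sign (punchOutℕ j i))
sign-punchOutℕ-antisym {zero}  {zero}  i≢j = ⊥-elim (i≢j refl)
sign-punchOutℕ-antisym {zero}  {suc j} _   rewrite sign-suc j = identity (sign j)
  where
  identity : ∀ s → + 1 * s ≡ - ((- s) * + 1)
  identity = solve-∀
sign-punchOutℕ-antisym {suc i} {zero}  _   rewrite sign-suc i = identity (sign i)
  where
  identity : ∀ s → (- s) * + 1 ≡ - (+ 1 * s)
  identity = solve-∀
sign-punchOutℕ-antisym {suc i} {suc j} i≢j
  rewrite sign-suc i | sign-suc j | sign-suc (punchOutℕ i j) | sign-suc (punchOutℕ j i) =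
  begin
    (- sign i) * (- sign (punchOutℕ i j))      ≡⟨ neg*neg (sign i) (sign (punchOutℕ i j)) ⟩
    sign i * sign (punchOutℕ i j)              ≡⟨ sign-punchOutℕ-antisym (i≢j ∘ cong suc) ⟩
    - (sign j * sign (punchOutℕ j i))          ≡⟨ cong -_ (neg*neg (sign j) (sign (punchOutℕ j i))) ⟨
    - ((- sign j) * (- sign (punchOutℕ j i)))  ∎
  where
  open ≡-Reasoning
  neg*neg : ∀ a b → (- a) * (- b) ≡ a * b
  neg*neg = solve-∀

sumℤ : ℕ → (ℕ → ℤ) → ℤ
sumℤ zero    g = + 0
sumℤ (suc n) g = g 0 + sumℤ n (g ∘ suc)

prodℤ : ℕ → (ℕ → ℤ) → ℤ
prodℤ zero    g = + 1
prodℤ (suc n) g = g 0 * prodℤ n (g ∘ suc)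

sumℤ-congᵇ : ∀ n {g h : ℕ → ℤ} → (∀ i → i < n → g i ≡ h i) → sumℤ n g ≡ sumℤ n h
sumℤ-congᵇ zero    eq = refl
sumℤ-congᵇ (suc n) eq = cong₂ _+_ (eq 0 (s≤s z≤n)) (sumℤ-congᵇ n (λ i i<n → eq (suc i) (s≤s i<n)))

sumℤ-cong : ∀ n {g h : ℕ → ℤ} → (∀ i → g i ≡ h i) → sumℤ n g ≡ sumℤ n h
sumℤ-cong n eq = sumℤ-congᵇ n (λ i _ → eq i)

prodℤ-congᵇ : ∀ n {g h : ℕ → ℤ} → (∀ i → i < n → g i ≡ h i) → prodℤ n g ≡ prodℤ n h
prodℤ-congᵇ zero    eq = refl
prodℤ-congᵇ (suc n) eq = cong₂ _*_ (eq 0 (s≤s z≤n)) (prodℤ-congᵇ n (λ i i<n → eq (suc i) (s≤s i<n)))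

sumℤ-0 : ∀ n (g : ℕ → ℤ) → (∀ i → i < n → g i ≡ + 0) → sumℤ n g ≡ + 0
sumℤ-0 zero    g eq = refl
sumℤ-0 (suc n) g eq = cong₂ _+_ (eq 0 (s≤s z≤n)) (sumℤ-0 n (g ∘ suc) (λ i i<n → eq (suc i) (s≤s i<n)))

sumℤ-distrib-+ : ∀ n (g h : ℕ → ℤ) → sumℤ n (λ i → g i + h i) ≡ sumℤ n g + sumℤ n h
sumℤ-distrib-+ zero    g h = refl
sumℤ-distrib-+ (suc n) g h rewrite sumℤ-distrib-+ n (g ∘ suc) (h ∘ suc) =
  middleFour (g 0) (h 0) (sumℤ n (g ∘ suc)) (sumℤ n (h ∘ suc))
  where
  middleFour : ∀ a b c e → (a + b) + (c + e) ≡ (a + c) + (b + e)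
  middleFour = solve-∀

sumℤ-*ˡ : ∀ n c (g : ℕ → ℤ) → sumℤ n (λ i → c * g i) ≡ c * sumℤ n g
sumℤ-*ˡ zero    c g = sym (ℤₚ.*-zeroʳ c)
sumℤ-*ˡ (suc n) c g rewrite sumℤ-*ˡ n c (g ∘ suc) = sym (ℤₚ.*-distribˡ-+ c (g 0) _)

sumℤ-neg : ∀ n (g : ℕ → ℤ) → sumℤ n (λ i → - g i) ≡ - sumℤ n g
sumℤ-neg zero    g = refl
sumℤ-neg (suc n) g rewrite sumℤ-neg n (g ∘ suc) = sym (ℤₚ.neg-distrib-+ (g 0) _)

sumℤ-punchInℕ : ∀ n i (g : ℕ → ℤ) → i ≤ n →
  sumℤ n (g ∘ punchInℕ i) + g i ≡ sumℤ (suc n) g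
sumℤ-punchInℕ n       zero    g _         = ℤₚ.+-comm _ (g 0)
sumℤ-punchInℕ (suc n) (suc i) g (s≤s i≤n) =
  trans (ℤₚ.+-assoc (g 0) _ (g (suc i))) (cong (_+_ (g 0)) (sumℤ-punchInℕ n i (g ∘ suc) i≤n))

prodℤ-punchInℕ : ∀ n i (g : ℕ → ℤ) → i ≤ n →
  g i * prodℤ n (g ∘ punchInℕ i) ≡ prodℤ (suc n) g
prodℤ-punchInℕ n       zero    g _         = refl
prodℤ-punchInℕ (suc n) (suc i) g (s≤s i≤n) =
  trans (swapFirst (g (suc i)) (g 0) (prodℤ n (g ∘ suc ∘ punchInℕ i)))
        (cong (g 0 *_) (prodℤ-punchInℕ n i (g ∘ suc) i≤n))
  where
  swapFirst : ∀ a b c → a * (b * c) ≡ b * (a * c)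
  swapFirst = solve-∀

sumℤ-comm : ∀ m n (h : ℕ → ℕ → ℤ) →
  sumℤ m (λ i → sumℤ n (h i)) ≡ sumℤ n (λ j → sumℤ m (λ i → h i j))
sumℤ-comm zero    n h = sym (sumℤ-0 n _ (λ _ _ → refl))
sumℤ-comm (suc m) n h =
  trans (cong (_+_ (sumℤ n (h 0))) (sumℤ-comm m n (h ∘ suc)))
        (sym (sumℤ-distrib-+ n (h 0) (λ j → sumℤ m (λ i → h (suc i) j))))

sumℤ-adjacentPair : ∀ n c (g : ℕ → ℤ) → suc c < n →
  (∀ i → i < n → i ≢ c → i ≢ suc c → g i ≡ + 0) → g c + g (suc c) ≡ + 0 → sumℤ n g ≡ + 0
sumℤ-adjacentPair (suc (suc n)) zero g _ rest pair =
  trans (sym (ℤₚ.+-assoc (g 0) (g 1) _))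
        (cong₂ _+_ pair (sumℤ-0 n _ (λ i i<n → rest (suc (suc i)) (s≤s (s≤s i<n)) (λ ()) (λ ()))))
sumℤ-adjacentPair (suc n) (suc c) g (s≤s c+1<n) rest pair =
  cong₂ _+_ (rest 0 (s≤s z≤n) (λ ()) (λ ()))
            (sumℤ-adjacentPair n c (g ∘ suc) c+1<n
              (λ i i<n i≢c i≢c+1 →
                 rest (suc i) (s≤s i<n) (i≢c ∘ ℕₚ.suc-injective) (i≢c+1 ∘ ℕₚ.suc-injective))
              pair)

x≡-x⇒x≡0 : ∀ x → x ≡ - x → x ≡ + 0
x≡-x⇒x≡0 x x≡-x = ℤₚ.*-cancelˡ-≡ (+ 2) x (+ 0) (begin
  + 2 * x    ≡⟨ double x ⟨
  x + x      ≡⟨ cong (_+_ x) x≡-x ⟩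
  x + - x    ≡⟨ ℤₚ.+-inverseʳ x ⟩
  + 0        ∎)
  where
  open ≡-Reasoning
  double : ∀ x → x + x ≡ + 2 * x
  double = solve-∀

-- With X the off-diagonal sum and Δ the diagonal, the full double sum is X + Δ summed by rows
-- and −X + Δ summed by columns.
sumℤ-offDiagonal-antisym : ∀ n (H : ℕ → ℕ → ℤ) → (∀ {j l} → j ≢ l → H j l ≡ - H l j) →
  sumℤ (suc n) (λ j → sumℤ n (H j ∘ punchInℕ j)) ≡ + 0
sumℤ-offDiagonal-antisym n H H-antisym = x≡-x⇒x≡0 X X≡-X
  where
  open ≡-Reasoning
  open import Algebra.Properties.AbelianGroup ℤₚ.+-0-abelianGroup using (∙-cancelʳ)
  X = sumℤ (suc n) (λ j → sumℤ n (H j ∘ punchInℕ j))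
  Δ = sumℤ (suc n) (λ j → H j j)

  rowsFirst : sumℤ (suc n) (λ j → sumℤ (suc n) (H j)) ≡ X + Δ
  rowsFirst = begin
    sumℤ (suc n) (λ j → sumℤ (suc n) (H j))
      ≡⟨ sumℤ-congᵇ (suc n) (λ j j< → sumℤ-punchInℕ n j (H j) (ℕₚ.≤-pred j<)) ⟨
    sumℤ (suc n) (λ j → sumℤ n (H j ∘ punchInℕ j) + H j j)
      ≡⟨ sumℤ-distrib-+ (suc n) (λ j → sumℤ n (H j ∘ punchInℕ j)) (λ j → H j j) ⟩
    X + Δ ∎

  columnsFirst : sumℤ (suc n) (λ l → sumℤ (suc n) (λ j → H j l)) ≡ - X + Δ
  columnsFirst = begin
    sumℤ (suc n) (λ l → sumℤ (suc n) (λ j → H j l))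
      ≡⟨ sumℤ-congᵇ (suc n) (λ l l< → sumℤ-punchInℕ n l (λ j → H j l) (ℕₚ.≤-pred l<)) ⟨
    sumℤ (suc n) (λ l → sumℤ n (λ c → H (punchInℕ l c) l) + H l l)
      ≡⟨ sumℤ-distrib-+ (suc n) (λ l → sumℤ n (λ c → H (punchInℕ l c) l)) (λ l → H l l) ⟩
    sumℤ (suc n) (λ l → sumℤ n (λ c → H (punchInℕ l c) l)) + Δ
      ≡⟨ cong (_+ Δ) (sumℤ-cong (suc n) λ l → sumℤ-cong n λ c → H-antisym (punchInℕᵢ≢i l c)) ⟩
    sumℤ (suc n) (λ l → sumℤ n (λ c → - H l (punchInℕ l c))) + Δ
      ≡⟨ cong (_+ Δ) (trans (sumℤ-cong (suc n) (λ l → sumℤ-neg n (H l ∘ punchInℕ l)))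
                            (sumℤ-neg (suc n) (λ l → sumℤ n (H l ∘ punchInℕ l)))) ⟩
    - X + Δ ∎

  X≡-X : X ≡ - X
  X≡-X = ∙-cancelʳ Δ X (- X) (trans (sym rowsFirst) (trans (sumℤ-comm (suc n) (suc n) H) columnsFirst))

-- Matrices indexed by ℕ rather than Fin, so that minors and row/column operations need no
-- transport; only the entries below the size passed to detℕ matter.
Matrix : Set
Matrix = ℕ → ℕ → ℤ

minor : Matrix → ℕ → Matrix
minor f j i l = f (suc i) (punchInℕ j l)

detℕ : ℕ → Matrix → ℤ
detℕ zero    f = + 1
detℕ (suc n) f = sumℤ (suc n) (λ j → sign j * f 0 j * detℕ n (minor f j))

toℕ-punchIn : ∀ {n} (i : Fin (suc n)) (j : Fin n) → toℕ (punchIn i j) ≡ punchInℕ (toℕ i) (toℕ j)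
toℕ-punchIn Fin.zero    j           = refl
toℕ-punchIn (Fin.suc i) Fin.zero    = refl
toℕ-punchIn (Fin.suc i) (Fin.suc j) = cong suc (toℕ-punchIn i j)

sumFin-cong : ∀ n {g h : Fin n → ℤ} → (∀ i → g i ≡ h i) → sumFin n g ≡ sumFin n h
sumFin-cong zero    eq = refl
sumFin-cong (suc n) eq = cong₂ _+_ (eq Fin.zero) (sumFin-cong n (eq ∘ Fin.suc))

sumFin≡sumℤ : ∀ n (g : ℕ → ℤ) → sumFin n (g ∘ toℕ) ≡ sumℤ n g
sumFin≡sumℤ zero    g = refl
sumFin≡sumℤ (suc n) g = cong (_+_ (g 0)) (sumFin≡sumℤ n (g ∘ suc))

det-cong : ∀ n {M N : Fin n → Fin n → ℤ} → (∀ i j → M i j ≡ N i j) → det n M ≡ det n N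
det-cong zero    eq = refl
det-cong (suc n) eq = sumFin-cong (suc n) λ j →
  cong₂ _*_ (cong (sign (toℕ j) *_) (eq Fin.zero j)) (det-cong n (λ i l → eq (Fin.suc i) (punchIn j l)))

det≡detℕ : ∀ n f → det n (λ i j → f (toℕ i) (toℕ j)) ≡ detℕ n f
det≡detℕ zero    f = refl
det≡detℕ (suc n) f = trans
  (sumFin-cong (suc n) λ j → cong (sign (toℕ j) * f 0 (toℕ j) *_)
    (trans (det-cong n (λ i l → cong (f (suc (toℕ i))) (toℕ-punchIn j l)))
           (det≡detℕ n (minor f (toℕ j)))))
  (sumFin≡sumℤ (suc n) (λ j → sign j * f 0 j * detℕ n (minor f j)))

detℕ-congᵇ : ∀ n {f g : Matrix} → (∀ i j → i < n → j < n → f i j ≡ g i j) → detℕ n f ≡ detℕ n g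
detℕ-congᵇ zero    eq = refl
detℕ-congᵇ (suc n) eq = sumℤ-congᵇ (suc n) λ j j<n →
  cong₂ _*_ (cong (sign j *_) (eq 0 j (s≤s z≤n) j<n))
            (detℕ-congᵇ n (λ i l i< l< → eq (suc i) (punchInℕ j l) (s≤s i<) (punchInℕ-< j l<)))

detℕ-cong : ∀ n {f g : Matrix} → (∀ i j → f i j ≡ g i j) → detℕ n f ≡ detℕ n g
detℕ-cong n eq = detℕ-congᵇ n (λ i j _ _ → eq i j)

-- Expanding along row 0 and then along row 1 writes the determinant as the off-diagonal part of
-- a double sum of H j l, and H is antisymmetric when rows 0 and 1 agree.
detℕ-equalRows₀₁ : ∀ n f → (∀ j → f 0 j ≡ f 1 j) → detℕ (suc (suc n)) f ≡ + 0
detℕ-equalRows₀₁ n f row₀≡row₁ =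
  trans (sumℤ-cong (suc (suc n)) expansion≡ΣH) (sumℤ-offDiagonal-antisym (suc n) H H-antisym)
  where
  H : ℕ → ℕ → ℤ
  H j l = sign j * sign (punchOutℕ j l) * (f 0 j * f 0 l)
        * detℕ n (λ i c → f (suc (suc i)) (punchInℕ j (punchInℕ (punchOutℕ j l) c)))

  rearrange : ∀ a b c e D → a * b * (c * e * D) ≡ a * c * (b * e) * D
  rearrange = solve-∀
  expansion≡ΣH : ∀ j → sign j * f 0 j * detℕ (suc n) (minor f j) ≡ sumℤ (suc n) (H j ∘ punchInℕ j)
  expansion≡ΣH j = trans
    (sym (sumℤ-*ˡ (suc n) (sign j * f 0 j) (λ l → sign l * f 1 (punchInℕ j l) * detℕ n (minor (minor f j) l))))
    (sumℤ-cong (suc n) term)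
    where
    term : ∀ l → sign j * f 0 j * (sign l * f 1 (punchInℕ j l) * detℕ n (minor (minor f j) l))
               ≡ H j (punchInℕ j l)
    term l rewrite punchOutℕ-punchInℕ j l | sym (row₀≡row₁ (punchInℕ j l)) =
      rearrange (sign j) (f 0 j) (sign l) (f 0 (punchInℕ j l)) _

  swapSign : ∀ s a b D → (- s) * (a * b) * D ≡ - (s * (b * a) * D)
  swapSign = solve-∀
  H-antisym : ∀ {j l} → j ≢ l → H j l ≡ - H l j
  H-antisym {j} {l} j≢l =
    trans (cong₂ (λ s D → s * (f 0 j * f 0 l) * D) (sign-punchOutℕ-antisym j≢l)
                 (detℕ-cong n (λ i c → cong (f (suc (suc i))) (punchInℕ-commute j≢l c))))
          (swapSign (sign l * sign (punchOutℕ l j)) (f 0 j) (f 0 l) _)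

detℕ-linear-row₀ : ∀ n f g h → (∀ j → f 0 j ≡ g 0 j + h 0 j) →
  (∀ i j → f (suc i) j ≡ g (suc i) j) → (∀ i j → f (suc i) j ≡ h (suc i) j) →
  detℕ (suc n) f ≡ detℕ (suc n) g + detℕ (suc n) h
detℕ-linear-row₀ n f g h row₀ f≡g f≡h =
  trans (sumℤ-cong (suc n) term) (sumℤ-distrib-+ (suc n) (expansion g) (expansion h))
  where
  expansion : Matrix → ℕ → ℤ
  expansion f j = sign j * f 0 j * detℕ n (minor f j)
  distrib : ∀ s a b D → s * (a + b) * D ≡ s * a * D + s * b * D
  distrib = solve-∀
  term : ∀ j → expansion f j ≡ expansion g j + expansion h j
  term j = begin
    sign j * f 0 j * detℕ n (minor f j)
      ≡⟨ cong₂ (λ a D → sign j * a * D) (row₀ j) (detℕ-cong n (λ i l → f≡g i (punchInℕ j l))) ⟩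
    sign j * (g 0 j + h 0 j) * detℕ n (minor g j)
      ≡⟨ distrib (sign j) (g 0 j) (h 0 j) _ ⟩
    sign j * g 0 j * detℕ n (minor g j) + sign j * h 0 j * detℕ n (minor g j)
      ≡⟨ cong (λ D → expansion g j + sign j * h 0 j * D)
              (detℕ-cong n (λ i l → trans (sym (f≡g i (punchInℕ j l))) (f≡h i (punchInℕ j l)))) ⟩
    expansion g j + expansion h j ∎
    where open ≡-Reasoning

row₀-duplicated : Matrix → Matrix
row₀-duplicated f (suc zero) j = f 0 j
row₀-duplicated f i          j = f i j

-- For r = 0 the new determinant splits, by linearity in row 0 of each minor, into the old one
-- plus that of a matrix with two equal rows.
detℕ-addRow : ∀ n r f g → suc r < n → (∀ i j → i ≢ suc r → g i j ≡ f i j) →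
  (∀ j → g (suc r) j ≡ f (suc r) j + f r j) → detℕ n f ≡ detℕ n g
detℕ-addRow (suc (suc n)) zero f g _ g≡f row₁ = sym (begin
  detℕ (suc (suc n)) g
    ≡⟨ sumℤ-cong (suc (suc n)) term ⟩
  sumℤ (suc (suc n)) (λ j → expansion f j + expansion f′ j)
    ≡⟨ sumℤ-distrib-+ (suc (suc n)) (expansion f) (expansion f′) ⟩
  detℕ (suc (suc n)) f + detℕ (suc (suc n)) f′
    ≡⟨ cong (_+_ (detℕ (suc (suc n)) f)) (detℕ-equalRows₀₁ n f′ (λ _ → refl)) ⟩
  detℕ (suc (suc n)) f + + 0
    ≡⟨ ℤₚ.+-identityʳ _ ⟩
  detℕ (suc (suc n)) f ∎)
  where
  open ≡-Reasoning
  f′ = row₀-duplicated f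
  expansion : Matrix → ℕ → ℤ
  expansion f j = sign j * f 0 j * detℕ (suc n) (minor f j)
  term : ∀ j → expansion g j ≡ expansion f j + expansion f′ j
  term j = trans
    (cong₂ (λ a D → sign j * a * D) (g≡f 0 j (λ ()))
      (detℕ-linear-row₀ n (minor g j) (minor f j) (minor f′ j) (row₁ ∘ punchInℕ j)
        (λ i l → g≡f (suc (suc i)) (punchInℕ j l) (λ ()))
        (λ i l → g≡f (suc (suc i)) (punchInℕ j l) (λ ()))))
    (ℤₚ.*-distribˡ-+ (sign j * f 0 j) (detℕ (suc n) (minor f j)) (detℕ (suc n) (minor f′ j)))
detℕ-addRow (suc n) (suc r) f g (s≤s r+1<n) g≡f row = sumℤ-cong (suc n) λ j →
  cong₂ (λ a D → sign j * a * D) (sym (g≡f 0 j (λ ())))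
    (detℕ-addRow n r (minor f j) (minor g j) r+1<n
      (λ i l i≢r → g≡f (suc i) (punchInℕ j l) (i≢r ∘ ℕₚ.suc-injective))
      (row ∘ punchInℕ j))

detℕ-linear-col : ∀ n c f g h → c < n → (∀ i j → j ≢ c → f i j ≡ g i j) →
  (∀ i j → j ≢ c → h i j ≡ g i j) → (∀ i → f i c ≡ g i c + h i c) →
  detℕ n f ≡ detℕ n g + detℕ n h
detℕ-linear-col (suc n) c f g h c<n f≡g h≡g col =
  trans (sumℤ-congᵇ (suc n) term) (sumℤ-distrib-+ (suc n) (expansion g) (expansion h))
  where
  open ≡-Reasoning
  expansion : Matrix → ℕ → ℤ
  expansion f j = sign j * f 0 j * detℕ n (minor f j)
  distrib : ∀ s a b D → s * (a + b) * D ≡ s * a * D + s * b * D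
  distrib = solve-∀
  term : ∀ j → j < suc n → expansion f j ≡ expansion g j + expansion h j
  term j j<n with j ℕ.≟ c
  ... | yes refl = begin
    sign j * f 0 j * detℕ n (minor f j)
      ≡⟨ cong₂ (λ a D → sign j * a * D) (col 0)
               (detℕ-cong n (λ i l → f≡g (suc i) (punchInℕ j l) (punchInℕᵢ≢i j l))) ⟩
    sign j * (g 0 j + h 0 j) * detℕ n (minor g j)
      ≡⟨ distrib (sign j) (g 0 j) (h 0 j) _ ⟩
    expansion g j + sign j * h 0 j * detℕ n (minor g j)
      ≡⟨ cong (λ D → expansion g j + sign j * h 0 j * D)
              (detℕ-cong n (λ i l → sym (h≡g (suc i) (punchInℕ j l) (punchInℕᵢ≢i j l)))) ⟩
    expansion g j + expansion h j ∎
  ... | no j≢c = begin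
    sign j * f 0 j * detℕ n (minor f j)
      ≡⟨ cong₂ (λ a D → sign j * a * D) (f≡g 0 j j≢c)
           (detℕ-linear-col n (punchOutℕ j c) (minor f j) (minor g j) (minor h j)
             (punchOutℕ-< j<n c<n j≢c)
             (λ i l l≢ → f≡g (suc i) (punchInℕ j l) (l≢ ∘ punchInℕ≡⇒≡punchOutℕ))
             (λ i l l≢ → h≡g (suc i) (punchInℕ j l) (l≢ ∘ punchInℕ≡⇒≡punchOutℕ))
             (λ i → subst (λ x → f (suc i) x ≡ g (suc i) x + h (suc i) x)
                          (sym (punchInℕ-punchOutℕ j≢c)) (col (suc i)))) ⟩
    sign j * g 0 j * (detℕ n (minor g j) + detℕ n (minor h j))
      ≡⟨ ℤₚ.*-distribˡ-+ (sign j * g 0 j) _ _ ⟩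
    expansion g j + sign j * g 0 j * detℕ n (minor h j)
      ≡⟨ cong (λ a → expansion g j + sign j * a * detℕ n (minor h j)) (sym (h≡g 0 j j≢c)) ⟩
    expansion g j + expansion h j ∎

-- Terms j ∉ {c, c + 1} of the expansion vanish by induction; the terms c and c + 1 cancel, because
-- their minors coincide and their signs are opposite.
detℕ-equalAdjacentCols : ∀ n c f → suc c < n → (∀ i → f i c ≡ f i (suc c)) → detℕ n f ≡ + 0
detℕ-equalAdjacentCols (suc n) c f c+1<n col = sumℤ-adjacentPair (suc n) c expansion c+1<n rest pair
  where
  expansion : ℕ → ℤ
  expansion j = sign j * f 0 j * detℕ n (minor f j)

  rest : ∀ j → j < suc n → j ≢ c → j ≢ suc c → expansion j ≡ + 0
  rest j j<n j≢c j≢c+1 = trans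
    (cong (_*_ (sign j * f 0 j)) (detℕ-equalAdjacentCols n (punchOutℕ j c) (minor f j) bound col′))
    (ℤₚ.*-zeroʳ (sign j * f 0 j))
    where
    bound : suc (punchOutℕ j c) < n
    bound = subst (_< n) (punchOutℕ-suc j≢c j≢c+1) (punchOutℕ-< j<n c+1<n j≢c+1)
    col′ : ∀ i → minor f j i (punchOutℕ j c) ≡ minor f j i (suc (punchOutℕ j c))
    col′ i = begin
      f (suc i) (punchInℕ j (punchOutℕ j c))         ≡⟨ cong (f (suc i)) (punchInℕ-punchOutℕ j≢c) ⟩
      f (suc i) c                                    ≡⟨ col (suc i) ⟩
      f (suc i) (suc c)                              ≡⟨ cong (f (suc i)) (punchInℕ-punchOutℕ j≢c+1) ⟨
      f (suc i) (punchInℕ j (punchOutℕ j (suc c)))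
        ≡⟨ cong (f (suc i) ∘ punchInℕ j) (punchOutℕ-suc j≢c j≢c+1) ⟩
      f (suc i) (punchInℕ j (suc (punchOutℕ j c)))   ∎
      where open ≡-Reasoning

  sameMinor : ∀ i l → f i (punchInℕ c l) ≡ f i (punchInℕ (suc c) l)
  sameMinor i l with punchInℕ-adjacent c l
  ... | inj₁ e          = cong (f i) e
  ... | inj₂ (e₁ , e₂) = trans (cong (f i) e₁) (trans (sym (col i)) (cong (f i) (sym e₂)))

  cancel : ∀ s a D → s * a * D + (- s) * a * D ≡ + 0
  cancel = solve-∀
  pair : expansion c + expansion (suc c) ≡ + 0
  pair = begin
    expansion c + sign (suc c) * f 0 (suc c) * detℕ n (minor f (suc c))
      ≡⟨ cong₂ (λ s a → expansion c + s * a * detℕ n (minor f (suc c))) (sign-suc c) (sym (col 0)) ⟩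
    expansion c + (- sign c) * f 0 c * detℕ n (minor f (suc c))
      ≡⟨ cong (λ D → expansion c + (- sign c) * f 0 c * D)
             (detℕ-cong n (λ i l → sym (sameMinor (suc i) l))) ⟩
    expansion c + (- sign c) * f 0 c * detℕ n (minor f c)
      ≡⟨ cancel (sign c) (f 0 c) _ ⟩
    + 0 ∎
    where open ≡-Reasoning

col-duplicated : ℕ → Matrix → Matrix
col-duplicated c f i j with j ℕ.≟ suc c
... | yes _ = f i c
... | no  _ = f i j

col-duplicated-≡ : ∀ c f i → col-duplicated c f i (suc c) ≡ f i c
col-duplicated-≡ c f i with suc c ℕ.≟ suc c
... | yes _     = refl
... | no  c≢c   = ⊥-elim (c≢c refl)

col-duplicated-≢ : ∀ c f i {j} → j ≢ suc c → col-duplicated c f i j ≡ f i j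
col-duplicated-≢ c f i {j} j≢c+1 with j ℕ.≟ suc c
... | yes j≡c+1 = ⊥-elim (j≢c+1 j≡c+1)
... | no  _     = refl

detℕ-addCol : ∀ n c f g → suc c < n → (∀ i j → j ≢ suc c → g i j ≡ f i j) →
  (∀ i → g i (suc c) ≡ f i (suc c) + f i c) → detℕ n f ≡ detℕ n g
detℕ-addCol n c f g c+1<n g≡f col = sym (begin
  detℕ n g
    ≡⟨ detℕ-linear-col n (suc c) g f f′ c+1<n g≡f (λ i j → col-duplicated-≢ c f i)
         (λ i → trans (col i) (cong (_+_ (f i (suc c))) (sym (col-duplicated-≡ c f i)))) ⟩
  detℕ n f + detℕ n f′
    ≡⟨ cong (_+_ (detℕ n f)) (detℕ-equalAdjacentCols n c f′ c+1<n
         (λ i → trans (col-duplicated-≢ c f i (ℕₚ.<⇒≢ (ℕₚ.n<1+n c))) (sym (col-duplicated-≡ c f i)))) ⟩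
  detℕ n f + + 0
    ≡⟨ ℤₚ.+-identityʳ _ ⟩
  detℕ n f ∎)
  where
  open ≡-Reasoning
  f′ = col-duplicated c f

regroup : ∀ s a b P D → s * (a * b) * (P * D) ≡ a * P * (s * b * D)
regroup = solve-∀

detℕ-scaleRows : ∀ n (u : ℕ → ℤ) f → detℕ n (λ i j → u i * f i j) ≡ prodℤ n u * detℕ n f
detℕ-scaleRows zero    u f = refl
detℕ-scaleRows (suc n) u f = trans (sumℤ-cong (suc n) term)
  (sumℤ-*ˡ (suc n) (prodℤ (suc n) u) (λ j → sign j * f 0 j * detℕ n (minor f j)))
  where
  term : ∀ j → sign j * (u 0 * f 0 j) * detℕ n (λ i l → u (suc i) * f (suc i) (punchInℕ j l))
             ≡ prodℤ (suc n) u * (sign j * f 0 j * detℕ n (minor f j))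
  term j = trans (cong (_*_ (sign j * (u 0 * f 0 j))) (detℕ-scaleRows n (u ∘ suc) (minor f j)))
                 (regroup (sign j) (u 0) (f 0 j) (prodℤ n (u ∘ suc)) (detℕ n (minor f j)))

detℕ-scaleCols : ∀ n (v : ℕ → ℤ) f → detℕ n (λ i j → v j * f i j) ≡ prodℤ n v * detℕ n f
detℕ-scaleCols zero    v f = refl
detℕ-scaleCols (suc n) v f = trans (sumℤ-congᵇ (suc n) term)
  (sumℤ-*ˡ (suc n) (prodℤ (suc n) v) (λ j → sign j * f 0 j * detℕ n (minor f j)))
  where
  term : ∀ j → j < suc n →
    sign j * (v j * f 0 j) * detℕ n (λ i l → v (punchInℕ j l) * f (suc i) (punchInℕ j l))
      ≡ prodℤ (suc n) v * (sign j * f 0 j * detℕ n (minor f j))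
  term j (s≤s j≤n) =
    trans (cong (_*_ (sign j * (v j * f 0 j))) (detℕ-scaleCols n (v ∘ punchInℕ j) (minor f j)))
      (trans (regroup (sign j) (v j) (f 0 j) (prodℤ n (v ∘ punchInℕ j)) (detℕ n (minor f j)))
             (cong (_* (sign j * f 0 j * detℕ n (minor f j))) (prodℤ-punchInℕ n j v j≤n)))

detℕ-unitRow₀ : ∀ n f → f 0 0 ≡ + 1 → (∀ j → f 0 (suc j) ≡ + 0) →
  detℕ (suc n) f ≡ detℕ n (λ i j → f (suc i) (suc j))
detℕ-unitRow₀ n f f₀₀≡1 f₀ⱼ≡0 = begin
  sign 0 * f 0 0 * detℕ n (minor f 0) + sumℤ n (λ j → sign (suc j) * f 0 (suc j) * detℕ n (minor f (suc j)))
    ≡⟨ cong₂ _+_ (cong (λ a → sign 0 * a * detℕ n (minor f 0)) f₀₀≡1)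
                 (sumℤ-0 n _ (λ j _ → trans (cong (λ a → sign (suc j) * a * detℕ n (minor f (suc j))) (f₀ⱼ≡0 j))
                                                     (vanish (sign (suc j)) _))) ⟩
  + 1 * detℕ n (minor f 0) + + 0
    ≡⟨ ℤₚ.+-identityʳ _ ⟩
  + 1 * detℕ n (minor f 0)
    ≡⟨ ℤₚ.*-identityˡ _ ⟩
  detℕ n (minor f 0) ∎
  where
  open ≡-Reasoning
  vanish : ∀ s D → s * + 0 * D ≡ + 0
  vanish = solve-∀

sweep : ℕ → (ℕ → ℤ) → ℕ → ℤ
sweep s v i with s ℕ.≤? i
... | yes _ = v i + v (i ∸ 1)
... | no  _ = v i

sweep-≥ : ∀ {s} v {i} → s ≤ i → sweep s v i ≡ v i + v (i ∸ 1)
sweep-≥ {s} v {i} s≤i with s ℕ.≤? i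
... | yes _   = refl
... | no  s≰i = ⊥-elim (s≰i s≤i)

sweep-< : ∀ {s} v {i} → i < s → sweep s v i ≡ v i
sweep-< {s} v {i} i<s with s ℕ.≤? i
... | yes s≤i = ⊥-elim (ℕₚ.<-irrefl refl (ℕₚ.<-≤-trans i<s s≤i))
... | no  _   = refl

sweep-suc-≢ : ∀ r v {i} → i ≢ suc r → sweep (suc r) v i ≡ sweep (suc (suc r)) v i
sweep-suc-≢ r v {i} i≢r+1 with ℕₚ.≤-<-connex (suc (suc r)) i
... | inj₁ r+2≤i = trans (sweep-≥ v (ℕₚ.≤-trans (ℕₚ.n≤1+n (suc r)) r+2≤i)) (sym (sweep-≥ v r+2≤i))
... | inj₂ i<r+2 = trans (sweep-< v (ℕₚ.≤∧≢⇒< (ℕₚ.≤-pred i<r+2) i≢r+1)) (sym (sweep-< v i<r+2))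

sweep-suc-≡ : ∀ r v → sweep (suc r) v (suc r) ≡ sweep (suc (suc r)) v (suc r) + sweep (suc (suc r)) v r
sweep-suc-≡ r v = trans (sweep-≥ v ℕₚ.≤-refl)
  (sym (cong₂ _+_ (sweep-< v (ℕₚ.n<1+n (suc r)))
                  (sweep-< v (ℕₚ.≤-trans (ℕₚ.n<1+n r) (ℕₚ.n≤1+n (suc r))))))

sweepRows : ℕ → Matrix → Matrix
sweepRows s f i j = sweep s (λ l → f l j) i

transpose : Matrix → Matrix
transpose f i j = f j i

-- The sweep from s is the sweep from s + 1 followed by adding row s − 1 to row s.
sweepRows-invariant : ∀ n (D : Matrix → ℤ) →
  (∀ {f g} → (∀ i j → i < n → f i j ≡ g i j) → D f ≡ D g) →
  (∀ r f g → suc r < n → (∀ i j → i ≢ suc r → g i j ≡ f i j) →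
     (∀ j → g (suc r) j ≡ f (suc r) j + f r j) → D f ≡ D g) →
  ∀ s f → 1 ≤ s → D f ≡ D (sweepRows s f)
sweepRows-invariant n D D-cong D-addRow s f 1≤s = go n s 1≤s (ℕₚ.m≤m+n n s)
  where
  go : ∀ e s → 1 ≤ s → n ≤ e ℕ.+ s → D f ≡ D (sweepRows s f)
  go e s _ n≤e+s with n ℕ.≤? s
  ... | yes n≤s = D-cong (λ i j i<n → sym (sweep-< (λ l → f l j) (ℕₚ.<-≤-trans i<n n≤s)))
  go zero    s       _ n≤s | no n≰s = ⊥-elim (n≰s n≤s)
  go (suc e) (suc r) _ n≤e+r+2 | no n≰r+1 = trans
    (go e (suc (suc r)) (s≤s z≤n) (subst (n ≤_) (sym (ℕₚ.+-suc e (suc r))) n≤e+r+2))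
    (D-addRow r (sweepRows (suc (suc r)) f) (sweepRows (suc r) f) (ℕₚ.≰⇒> n≰r+1)
      (λ i j → sweep-suc-≢ r (λ l → f l j)) (λ j → sweep-suc-≡ r (λ l → f l j)))

detℕ-sweepRows : ∀ n s f → 1 ≤ s → detℕ n f ≡ detℕ n (sweepRows s f)
detℕ-sweepRows n = sweepRows-invariant n (detℕ n)
  (λ eq → detℕ-congᵇ n (λ i j i<n _ → eq i j i<n)) (detℕ-addRow n)

detℕ-sweepCols : ∀ n s f → 1 ≤ s → detℕ n f ≡ detℕ n (transpose (sweepRows s (transpose f)))
detℕ-sweepCols n s f = sweepRows-invariant n (detℕ n ∘ transpose)
  (λ eq → detℕ-congᵇ n (λ i j _ j<n → eq j i j<n))
  (λ r f g r+1<n g≡f col → detℕ-addCol n r (transpose f) (transpose g) r+1<n (λ i j → g≡f j i) col)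
  s (transpose f)

binomℤ-pascal : ∀ a x → binomℤ (suc a) x ≡ binomℤ a x + binomℤ a (x - + 1)
binomℤ-pascal a (+ zero)    = refl
binomℤ-pascal a (+ suc r)   = begin
  + (suc a C suc r)           ≡⟨ cong +_ (nCk+nC[k+1]≡[n+1]C[k+1] a r) ⟨
  + (a C r ℕ.+ a C suc r)     ≡⟨ ℤₚ.+-comm (+ (a C r)) (+ (a C suc r)) ⟩
  + (a C suc r) + + (a C r)   ∎
  where open ≡-Reasoning
binomℤ-pascal a -[1+ r ]   = refl

lowerIndex-pred : ∀ a j → + suc a - + j - + 1 ≡ + a - + j
lowerIndex-pred a j = identity (+ a) (+ j)
  where
  identity : ∀ x y → (+ 1 + x) - y - + 1 ≡ x - y
  identity = solve-∀

-- Raising the upper index of row i by min(i, t): t = 0 is the Toeplitz matrix binom(n, k + i − j),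
-- and each step t → t + 1 is a row sweep, by Pascal's rule.
rowPascal : ℕ → ℕ → ℕ → Matrix
rowPascal n k t i j = binomℤ (n ℕ.+ i ⊓ t) (+ (k ℕ.+ i) - + j)

rowPascal-suc : ∀ n k t i j → rowPascal n k (suc t) i j ≡ sweepRows (suc t) (rowPascal n k t) i j
rowPascal-suc n k t i j with ℕₚ.≤-<-connex (suc t) i
... | inj₂ i<t+1 = trans
  (cong (λ m → binomℤ (n ℕ.+ m) (+ (k ℕ.+ i) - + j))
        (trans (ℕₚ.m≤n⇒m⊓n≡m (ℕₚ.<⇒≤ i<t+1)) (sym (ℕₚ.m≤n⇒m⊓n≡m (ℕₚ.≤-pred i<t+1)))))
  (sym (sweep-< (λ l → rowPascal n k t l j) i<t+1))
rowPascal-suc n k t (suc i) j | inj₁ (s≤s t≤i) = begin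
  binomℤ (n ℕ.+ suc (i ⊓ t)) L
    ≡⟨ cong (λ m → binomℤ m L) (trans (cong (λ m → n ℕ.+ suc m) i⊓t≡t) (ℕₚ.+-suc n t)) ⟩
  binomℤ (suc (n ℕ.+ t)) L
    ≡⟨ binomℤ-pascal (n ℕ.+ t) L ⟩
  binomℤ (n ℕ.+ t) L + binomℤ (n ℕ.+ t) (L - + 1)
    ≡⟨ cong₂ _+_ (cong (λ m → binomℤ (n ℕ.+ m) L) (sym i+1⊓t≡t))
                 (cong₂ binomℤ (cong (n ℕ.+_) (sym i⊓t≡t))
                               (trans (cong (λ m → + m - + j - + 1) (ℕₚ.+-suc k i)) (lowerIndex-pred (k ℕ.+ i) j))) ⟩
  rowPascal n k t (suc i) j + rowPascal n k t i j
    ≡⟨ sweep-≥ (λ l → rowPascal n k t l j) (s≤s t≤i) ⟨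
  sweepRows (suc t) (rowPascal n k t) (suc i) j ∎
  where
  open ≡-Reasoning
  L = + (k ℕ.+ suc i) - + j
  i⊓t≡t = ℕₚ.m≥n⇒m⊓n≡n t≤i
  i+1⊓t≡t = ℕₚ.m≥n⇒m⊓n≡n (ℕₚ.m≤n⇒m≤1+n t≤i)

-- Raising the upper index of column j by min(j, t) and lowering the shift by the same amount;
-- t = 0 is binom(n + i, k + i − j) and each step is a column sweep.
colPascal : ℕ → ℕ → ℕ → Matrix
colPascal n k t i j = binomℤ (n ℕ.+ i ℕ.+ j ⊓ t) (+ (k ℕ.+ i) - + (j ∸ t))

colPascal-suc : ∀ n k t i j →
  colPascal n k (suc t) i j ≡ transpose (sweepRows (suc t) (transpose (colPascal n k t))) i j
colPascal-suc n k t i j with ℕₚ.≤-<-connex (suc t) j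
... | inj₂ j<t+1 = trans
  (cong₂ (λ m e → binomℤ (n ℕ.+ i ℕ.+ m) (+ (k ℕ.+ i) - + e))
         (trans (ℕₚ.m≤n⇒m⊓n≡m (ℕₚ.<⇒≤ j<t+1)) (sym (ℕₚ.m≤n⇒m⊓n≡m (ℕₚ.≤-pred j<t+1))))
         (trans (ℕₚ.m≤n⇒m∸n≡0 (ℕₚ.<⇒≤ j<t+1)) (sym (ℕₚ.m≤n⇒m∸n≡0 (ℕₚ.≤-pred j<t+1)))))
  (sym (sweep-< (colPascal n k t i) j<t+1))
colPascal-suc n k t i (suc j) | inj₁ (s≤s t≤j) = begin
  binomℤ (N ℕ.+ suc (j ⊓ t)) (c - + (j ∸ t))
    ≡⟨ cong (λ m → binomℤ m (c - + (j ∸ t))) (trans (cong (λ m → N ℕ.+ suc m) j⊓t≡t) (ℕₚ.+-suc N t)) ⟩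
  binomℤ (suc (N ℕ.+ t)) (c - + (j ∸ t))
    ≡⟨ binomℤ-pascal (N ℕ.+ t) (c - + (j ∸ t)) ⟩
  binomℤ (N ℕ.+ t) (c - + (j ∸ t)) + binomℤ (N ℕ.+ t) (c - + (j ∸ t) - + 1)
    ≡⟨ ℤₚ.+-comm (binomℤ (N ℕ.+ t) (c - + (j ∸ t))) _ ⟩
  binomℤ (N ℕ.+ t) (c - + (j ∸ t) - + 1) + binomℤ (N ℕ.+ t) (c - + (j ∸ t))
    ≡⟨ cong₂ _+_ (cong₂ binomℤ (cong (N ℕ.+_) (sym j+1⊓t≡t))
                               (trans (shift (j ∸ t)) (cong (λ e → c - + e) (sym (ℕₚ.+-∸-assoc 1 t≤j)))))
                 (cong (λ m → binomℤ (N ℕ.+ m) (c - + (j ∸ t))) (sym j⊓t≡t)) ⟩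
  colPascal n k t i (suc j) + colPascal n k t i j
    ≡⟨ sweep-≥ (colPascal n k t i) (s≤s t≤j) ⟨
  sweep (suc t) (colPascal n k t i) (suc j) ∎
  where
  open ≡-Reasoning
  N = n ℕ.+ i
  c = + (k ℕ.+ i)
  j⊓t≡t = ℕₚ.m≥n⇒m⊓n≡n t≤j
  j+1⊓t≡t = ℕₚ.m≥n⇒m⊓n≡n (ℕₚ.m≤n⇒m≤1+n t≤j)
  shift : ∀ e → c - + e - + 1 ≡ c - + suc e
  shift e = identity c (+ e)
    where
    identity : ∀ x y → x - y - + 1 ≡ x - (+ 1 + y)
    identity = solve-∀

detℕ-rowPascal : ∀ d n k t → detℕ d (rowPascal n k 0) ≡ detℕ d (rowPascal n k t)
detℕ-rowPascal d n k zero    = refl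
detℕ-rowPascal d n k (suc t) = trans (detℕ-rowPascal d n k t)
  (trans (detℕ-sweepRows d (suc t) (rowPascal n k t) (s≤s z≤n))
         (detℕ-cong d (λ i j → sym (rowPascal-suc n k t i j))))

detℕ-colPascal : ∀ d n k t → detℕ d (colPascal n k 0) ≡ detℕ d (colPascal n k t)
detℕ-colPascal d n k zero    = refl
detℕ-colPascal d n k (suc t) = trans (detℕ-colPascal d n k t)
  (trans (detℕ-sweepCols d (suc t) (colPascal n k t) (s≤s z≤n))
         (detℕ-cong d (λ i j → sym (colPascal-suc n k t i j))))

toeplitzBinom : ℕ → ℕ → Matrix
toeplitzBinom n k i j = binomℤ n (+ (k ℕ.+ i) - + j)

hankelBinomᵀ : ℕ → ℕ → Matrix
hankelBinomᵀ n k i j = binomℤ (n ℕ.+ i ℕ.+ j) (+ (k ℕ.+ i))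

detℕ-toeplitz≡detℕ-hankelᵀ : ∀ d n k → detℕ d (toeplitzBinom n k) ≡ detℕ d (hankelBinomᵀ n k)
detℕ-toeplitz≡detℕ-hankelᵀ d n k = begin
  detℕ d (toeplitzBinom n k)
    ≡⟨ detℕ-cong d (λ i j → cong (λ m → binomℤ m (+ (k ℕ.+ i) - + j)) n+i⊓0≡n) ⟨
  detℕ d (rowPascal n k 0)
    ≡⟨ detℕ-rowPascal d n k d ⟩
  detℕ d (rowPascal n k d)
    ≡⟨ detℕ-congᵇ d (λ i j i<d _ → cong (λ m → binomℤ m (+ (k ℕ.+ i) - + j)) (rows≡cols i j i<d)) ⟩
  detℕ d (colPascal n k 0)
    ≡⟨ detℕ-colPascal d n k d ⟩
  detℕ d (colPascal n k d)
    ≡⟨ detℕ-congᵇ d (λ i j _ j<d → cong₂ binomℤ (cong (n ℕ.+ i ℕ.+_) (ℕₚ.m≤n⇒m⊓n≡m (ℕₚ.<⇒≤ j<d)))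
                                                 (noShift i j j<d)) ⟩
  detℕ d (hankelBinomᵀ n k) ∎
  where
  open ≡-Reasoning
  n+i⊓0≡n : ∀ {i} → n ℕ.+ i ⊓ 0 ≡ n
  n+i⊓0≡n {i} = trans (cong (n ℕ.+_) (ℕₚ.⊓-zeroʳ i)) (ℕₚ.+-identityʳ n)
  rows≡cols : ∀ i j → i < d → n ℕ.+ i ⊓ d ≡ n ℕ.+ i ℕ.+ j ⊓ 0
  rows≡cols i j i<d = begin
    n ℕ.+ i ⊓ d          ≡⟨ cong (n ℕ.+_) (ℕₚ.m≤n⇒m⊓n≡m (ℕₚ.<⇒≤ i<d)) ⟩
    n ℕ.+ i              ≡⟨ ℕₚ.+-identityʳ (n ℕ.+ i) ⟨
    n ℕ.+ i ℕ.+ 0        ≡⟨ cong (n ℕ.+ i ℕ.+_) (ℕₚ.⊓-zeroʳ j) ⟨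
    n ℕ.+ i ℕ.+ j ⊓ 0    ∎
  noShift : ∀ i j → j < d → + (k ℕ.+ i) - + (j ∸ d) ≡ + (k ℕ.+ i)
  noShift i j j<d = trans (cong (λ e → + (k ℕ.+ i) - + e) (ℕₚ.m≤n⇒m∸n≡0 (ℕₚ.<⇒≤ j<d)))
                          (ℤₚ.+-identityʳ (+ (k ℕ.+ i)))

lowerIndex-suc : ∀ a b → + suc a - + suc b ≡ + a - + b
lowerIndex-suc a b = identity (+ a) (+ b)
  where
  identity : ∀ x y → (+ 1 + x) - (+ 1 + y) ≡ x - y
  identity = solve-∀

detℕ-toeplitzBinom-0 : ∀ d n → detℕ d (toeplitzBinom n 0) ≡ + 1
detℕ-toeplitzBinom-0 zero    n = refl
detℕ-toeplitzBinom-0 (suc d) n = begin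
  detℕ (suc d) (toeplitzBinom n 0)
    ≡⟨ detℕ-unitRow₀ d (toeplitzBinom n 0) refl (λ _ → refl) ⟩
  detℕ d (λ i j → binomℤ n (+ suc i - + suc j))
    ≡⟨ detℕ-cong d (λ i j → cong (binomℤ n) (lowerIndex-suc i j)) ⟩
  detℕ d (toeplitzBinom n 0)
    ≡⟨ detℕ-toeplitzBinom-0 d n ⟩
  + 1 ∎
  where open ≡-Reasoning

nCk*[n∸k]≡nC[k+1]*[k+1] : ∀ n k → (n C k) ℕ.* (n ∸ k) ≡ (n C suc k) ℕ.* suc k
nCk*[n∸k]≡nC[k+1]*[k+1] zero    k = begin
  (0 C k) ℕ.* (0 ∸ k)    ≡⟨ cong ((0 C k) ℕ.*_) (ℕₚ.0∸n≡0 k) ⟩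
  (0 C k) ℕ.* 0          ≡⟨ ℕₚ.*-zeroʳ (0 C k) ⟩
  0                      ≡⟨ cong (ℕ._* suc k) (k>n⇒nCk≡0 {0} {suc k} (s≤s z≤n)) ⟨
  (0 C suc k) ℕ.* suc k  ∎
  where open ≡-Reasoning
nCk*[n∸k]≡nC[k+1]*[k+1] (suc n) zero =
  trans (ℕₚ.*-identityˡ (suc n)) (sym (trans (ℕₚ.*-identityʳ _) (nC1≡n (suc n))))
nCk*[n∸k]≡nC[k+1]*[k+1] (suc n) (suc k) = begin
  (suc n C suc k) ℕ.* (n ∸ k)
    ≡⟨ cong (ℕ._* (n ∸ k)) (nCk+nC[k+1]≡[n+1]C[k+1] n k) ⟨
  (a ℕ.+ b) ℕ.* (n ∸ k)
    ≡⟨ ℕₚ.*-distribʳ-+ (n ∸ k) a b ⟩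
  a ℕ.* (n ∸ k) ℕ.+ b ℕ.* (n ∸ k)
    ≡⟨ cong₂ ℕ._+_ (nCk*[n∸k]≡nC[k+1]*[k+1] n k) b*[n∸k] ⟩
  b ℕ.* suc k ℕ.+ (b ℕ.+ b ℕ.* (n ∸ suc k))
    ≡⟨ cong (λ x → b ℕ.* suc k ℕ.+ (b ℕ.+ x)) (nCk*[n∸k]≡nC[k+1]*[k+1] n (suc k)) ⟩
  b ℕ.* suc k ℕ.+ (b ℕ.+ c ℕ.* suc (suc k))
    ≡⟨ regroupℕ b c (suc k) ⟩
  (b ℕ.+ c) ℕ.* suc (suc k)
    ≡⟨ cong (ℕ._* suc (suc k)) (nCk+nC[k+1]≡[n+1]C[k+1] n (suc k)) ⟩
  (suc n C suc (suc k)) ℕ.* suc (suc k) ∎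
  where
  open ≡-Reasoning
  a = n C k
  b = n C suc k
  c = n C suc (suc k)
  regroupℕ : ∀ b c s → b ℕ.* s ℕ.+ (b ℕ.+ c ℕ.* (1 ℕ.+ s)) ≡ (b ℕ.+ c) ℕ.* (1 ℕ.+ s)
  regroupℕ = ℕ-Solver.solve-∀
  -- if k ≥ n then b = 0 and both sides vanish
  b*[n∸k] : b ℕ.* (n ∸ k) ≡ b ℕ.+ b ℕ.* (n ∸ suc k)
  b*[n∸k] with k ℕ.<? n
  ... | yes k<n = trans (cong (b ℕ.*_) (ℕₚ.+-∸-assoc 1 k<n)) (ℕₚ.*-suc b (n ∸ suc k))
  ... | no  k≮n rewrite k>n⇒nCk≡0 {n} {suc k} (s≤s (ℕₚ.≮⇒≥ k≮n)) = refl

[n+i+j]∸[k+i]≡[n∸k]+j : ∀ n k i j → k ≤ n → n ℕ.+ i ℕ.+ j ∸ (k ℕ.+ i) ≡ n ∸ k ℕ.+ j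
[n+i+j]∸[k+i]≡[n∸k]+j n k i j k≤n = begin
  n ℕ.+ i ℕ.+ j ∸ (k ℕ.+ i)               ≡⟨ cong (λ x → x ℕ.+ i ℕ.+ j ∸ (k ℕ.+ i)) (ℕₚ.m∸n+n≡m k≤n) ⟨
  n ∸ k ℕ.+ k ℕ.+ i ℕ.+ j ∸ (k ℕ.+ i)     ≡⟨ cong (_∸ (k ℕ.+ i)) (regroupℕ (n ∸ k) k i j) ⟩
  n ∸ k ℕ.+ j ℕ.+ (k ℕ.+ i) ∸ (k ℕ.+ i)   ≡⟨ ℕₚ.m+n∸n≡m (n ∸ k ℕ.+ j) (k ℕ.+ i) ⟩
  n ∸ k ℕ.+ j                             ∎
  where
  open ≡-Reasoning
  regroupℕ : ∀ m k i j → m ℕ.+ k ℕ.+ i ℕ.+ j ≡ m ℕ.+ j ℕ.+ (k ℕ.+ i)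
  regroupℕ = ℕ-Solver.solve-∀

detℕ-hankelᵀ-suc : ∀ d n k → k < n →
  prodℤ d (λ i → + (suc k ℕ.+ i)) * detℕ d (hankelBinomᵀ n (suc k))
    ≡ prodℤ d (λ j → + (n ∸ k ℕ.+ j)) * detℕ d (hankelBinomᵀ n k)
detℕ-hankelᵀ-suc d n k k<n =
  trans (sym (detℕ-scaleRows d (λ i → + (suc k ℕ.+ i)) (hankelBinomᵀ n (suc k))))
        (trans (detℕ-cong d entry) (detℕ-scaleCols d (λ j → + (n ∸ k ℕ.+ j)) (hankelBinomᵀ n k)))
  where
  entry : ∀ i j → + (suc k ℕ.+ i) * hankelBinomᵀ n (suc k) i j ≡ + (n ∸ k ℕ.+ j) * hankelBinomᵀ n k i j
  entry i j = trans (sym (ℤₚ.pos-* (suc (k ℕ.+ i)) (N C suc (k ℕ.+ i)))) (trans (cong +_ (begin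
    suc (k ℕ.+ i) ℕ.* (N C suc (k ℕ.+ i)) ≡⟨ ℕₚ.*-comm (suc (k ℕ.+ i)) _ ⟩
    (N C suc (k ℕ.+ i)) ℕ.* suc (k ℕ.+ i) ≡⟨ nCk*[n∸k]≡nC[k+1]*[k+1] N (k ℕ.+ i) ⟨
    (N C (k ℕ.+ i)) ℕ.* (N ∸ (k ℕ.+ i))
      ≡⟨ cong ((N C (k ℕ.+ i)) ℕ.*_) ([n+i+j]∸[k+i]≡[n∸k]+j n k i j (ℕₚ.<⇒≤ k<n)) ⟩
    (N C (k ℕ.+ i)) ℕ.* (n ∸ k ℕ.+ j)     ≡⟨ ℕₚ.*-comm (N C (k ℕ.+ i)) _ ⟩
    (n ∸ k ℕ.+ j) ℕ.* (N C (k ℕ.+ i))     ∎)) (ℤₚ.pos-* (n ∸ k ℕ.+ j) (N C (k ℕ.+ i))))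
    where
    open ≡-Reasoning
    N = n ℕ.+ i ℕ.+ j

prodℤ-rising : ∀ d m → prodℤ d (λ i → + (m ℕ.+ i)) ≡ + (d ! ℕ.* angle d m)
prodℤ-rising zero    m = refl
prodℤ-rising (suc d) m = begin
  + (m ℕ.+ 0) * prodℤ d (λ i → + (m ℕ.+ suc i))
    ≡⟨ cong₂ _*_ (cong +_ (ℕₚ.+-identityʳ m))
                 (trans (prodℤ-congᵇ d (λ i _ → cong +_ (ℕₚ.+-suc m i))) (prodℤ-rising d (suc m))) ⟩
  + m * + (d ! ℕ.* X)
    ≡⟨ ℤₚ.pos-* m (d ! ℕ.* X) ⟨
  + (m ℕ.* (d ! ℕ.* X))
    ≡⟨ cong +_ (begin
        m ℕ.* (d ! ℕ.* X)           ≡⟨ swap₁ m (d !) X ⟩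
        d ! ℕ.* (X ℕ.* m)           ≡⟨ cong (d ! ℕ.*_) X*m≡Y*[d+1] ⟩
        d ! ℕ.* (Y ℕ.* suc d)       ≡⟨ swap₂ (d !) Y (suc d) ⟩
        suc d ! ℕ.* Y               ∎) ⟩
  + (suc d ! ℕ.* Y)
    ≡⟨ cong (λ x → + (suc d ! ℕ.* (x C suc d))) (cong (_∸ 1) (ℕₚ.+-suc m d)) ⟨
  + (suc d ! ℕ.* angle (suc d) m) ∎
  where
  open ≡-Reasoning
  X = (m ℕ.+ d) C d
  Y = (m ℕ.+ d) C suc d
  X*m≡Y*[d+1] : X ℕ.* m ≡ Y ℕ.* suc d
  X*m≡Y*[d+1] = trans (cong (X ℕ.*_) (sym (ℕₚ.m+n∸n≡m m d))) (nCk*[n∸k]≡nC[k+1]*[k+1] (m ℕ.+ d) d)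
  swap₁ : ∀ a b c → a ℕ.* (b ℕ.* c) ≡ b ℕ.* (c ℕ.* a)
  swap₁ = ℕ-Solver.solve-∀
  swap₂ : ∀ a b c → a ℕ.* (b ℕ.* c) ≡ (c ℕ.* a) ℕ.* b
  swap₂ = ℕ-Solver.solve-∀

prodℕ : ℕ → (ℕ → ℕ) → ℕ
prodℕ zero    f = 1
prodℕ (suc k) f = prodℕ k f ℕ.* f k

prodℕ-suc : ∀ k f → prodℕ (suc k) f ≡ f 0 ℕ.* prodℕ k (f ∘ suc)
prodℕ-suc zero    f = trans (ℕₚ.*-identityˡ (f 0)) (sym (ℕₚ.*-identityʳ (f 0)))
prodℕ-suc (suc k) f = trans (cong (ℕ._* f (suc k)) (prodℕ-suc k f)) (ℕₚ.*-assoc (f 0) _ (f (suc k)))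

prodℕ>0 : ∀ k f → (∀ j → j < k → 0 < f j) → 0 < prodℕ k f
prodℕ>0 zero    f _   = s≤s z≤n
prodℕ>0 (suc k) f f>0 =
  ℕₚ.*-mono-≤ (prodℕ>0 k f (λ j j<k → f>0 j (ℕₚ.m<n⇒m<1+n j<k))) (f>0 k (ℕₚ.n<1+n k))

-- ℚᵘ stores the denominator minus one.
frac≃ : ∀ a b → 0 < b → ℚ.toℚᵘ (frac a b) ℚᵘ.≃ ℚᵘ.mkℚᵘ (+ a) (ℕ.pred b)
frac≃ a (suc b) _ = ℚₚ.toℚᵘ-fromℚᵘ (ℚᵘ.mkℚᵘ (+ a) b)

mkℚᵘ-* : ∀ a b c e → 0 < b → 0 < e →
  ℚᵘ.mkℚᵘ (+ a) (ℕ.pred b) ℚᵘ.* ℚᵘ.mkℚᵘ (+ c) (ℕ.pred e)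
    ℚᵘ.≃ ℚᵘ.mkℚᵘ (+ (a ℕ.* c)) (ℕ.pred (b ℕ.* e))
mkℚᵘ-* a (suc b) c (suc e) _ _ =
  ℚᵘₚ.≃-reflexive (cong (λ x → ℚᵘ.mkℚᵘ x (ℕ.pred (suc b ℕ.* suc e))) (sym (ℤₚ.pos-* a c)))

prodℚ-frac≃ : ∀ k (a b : ℕ → ℕ) → (∀ j → j < k → 0 < b j) →
  ℚ.toℚᵘ (prodℚ k (λ j → frac (a j) (b j))) ℚᵘ.≃ ℚᵘ.mkℚᵘ (+ prodℕ k a) (ℕ.pred (prodℕ k b))
prodℚ-frac≃ zero    a b _   = ℚᵘₚ.≃-refl
prodℚ-frac≃ (suc k) a b b>0 = begin
  ℚ.toℚᵘ (prodℚ k q ℚ.* q k)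
    ≈⟨ ℚₚ.toℚᵘ-homo-* (prodℚ k q) (q k) ⟩
  ℚ.toℚᵘ (prodℚ k q) ℚᵘ.* ℚ.toℚᵘ (q k)
    ≈⟨ ℚᵘₚ.*-cong (prodℚ-frac≃ k a b b>0′) (frac≃ (a k) (b k) bₖ>0) ⟩
  ℚᵘ.mkℚᵘ (+ prodℕ k a) (ℕ.pred (prodℕ k b)) ℚᵘ.* ℚᵘ.mkℚᵘ (+ a k) (ℕ.pred (b k))
    ≈⟨ mkℚᵘ-* (prodℕ k a) (prodℕ k b) (a k) (b k) (prodℕ>0 k b b>0′) bₖ>0 ⟩
  ℚᵘ.mkℚᵘ (+ prodℕ (suc k) a) (ℕ.pred (prodℕ (suc k) b)) ∎
  where
  open ℚᵘₚ.≃-Reasoning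
  q = λ j → frac (a j) (b j)
  bₖ>0 = b>0 k (ℕₚ.n<1+n k)
  b>0′ : ∀ j → j < k → 0 < b j
  b>0′ j j<k = b>0 j (ℕₚ.m<n⇒m<1+n j<k)

prodℚ-frac≡/1 : ∀ k (a b : ℕ → ℕ) (D : ℤ) → (∀ j → j < k → 0 < b j) →
  D * + prodℕ k b ≡ + prodℕ k a → prodℚ k (λ j → frac (a j) (b j)) ≡ D / 1
prodℚ-frac≡/1 k a b D b>0 D*Πb≡Πa = ℚₚ.toℚᵘ-injective (begin
  ℚ.toℚᵘ (prodℚ k (λ j → frac (a j) (b j)))       ≈⟨ prodℚ-frac≃ k a b b>0 ⟩
  ℚᵘ.mkℚᵘ (+ prodℕ k a) (ℕ.pred (prodℕ k b))      ≈⟨ ℚᵘ.*≡* cross ⟩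
  ℚᵘ.mkℚᵘ D 0                                      ≈⟨ ℚₚ.toℚᵘ-fromℚᵘ (ℚᵘ.mkℚᵘ D 0) ⟨
  ℚ.toℚᵘ (D / 1)                                  ∎)
  where
  open ℚᵘₚ.≃-Reasoning
  cross : + prodℕ k a * + 1 ≡ D * + suc (ℕ.pred (prodℕ k b))
  cross = trans (ℤₚ.*-identityʳ (+ prodℕ k a)) (trans (sym D*Πb≡Πa)
    (cong (λ x → D * + x) (sym (ℕₚ.suc-pred (prodℕ k b) {{ℕ.>-nonZero (prodℕ>0 k b b>0)}}))))

nCk>0 : ∀ {n k} → k ≤ n → 0 < n C k
nCk>0 {n}     {zero}  _         = s≤s z≤n
nCk>0 {suc n} {suc k} (s≤s k≤n) =
  subst (0 <_) (nCk+nC[k+1]≡[n+1]C[k+1] n k) (ℕₚ.<-≤-trans (nCk>0 k≤n) (ℕₚ.m≤m+n (n C k) _))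

module _ (d : ℕ) where

  angle>0 : ∀ {m} → 0 < m → 0 < angle d m
  angle>0 {suc m} _ = nCk>0 (ℕₚ.m≤n+m d m)

  -- angle! k and angleFalling n k are the denominator and numerator of gbinom d n k.
  angle! : ℕ → ℕ
  angle! k = prodℕ k (λ j → angle d (k ∸ j))

  angleFalling : ℕ → ℕ → ℕ
  angleFalling n k = prodℕ k (λ j → angle d (n ∸ j))

  angle!-suc : ∀ k → angle! (suc k) ≡ angle d (suc k) ℕ.* angle! k
  angle!-suc k = prodℕ-suc k (λ j → angle d (suc k ∸ j))

  angle!>0 : ∀ k → 0 < angle! k
  angle!>0 k = prodℕ>0 k (λ j → angle d (k ∸ j)) (λ j j<k → angle>0 (ℕₚ.m<n⇒0<n∸m j<k))

  angleFalling*angle! : ∀ {n} k → k ≤ n → angleFalling n k ℕ.* angle! (n ∸ k) ≡ angle! n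
  angleFalling*angle!     zero    _   = ℕₚ.*-identityˡ _
  angleFalling*angle! {n} (suc k) k<n = begin
    angleFalling n k ℕ.* angle d (n ∸ k) ℕ.* angle! (n ∸ suc k)
      ≡⟨ ℕₚ.*-assoc (angleFalling n k) _ _ ⟩
    angleFalling n k ℕ.* (angle d (n ∸ k) ℕ.* angle! (n ∸ suc k))
      ≡⟨ cong (λ m → angleFalling n k ℕ.* (angle d m ℕ.* angle! (n ∸ suc k))) n∸k≡1+n∸[k+1] ⟩
    angleFalling n k ℕ.* (angle d (suc (n ∸ suc k)) ℕ.* angle! (n ∸ suc k))
      ≡⟨ cong (angleFalling n k ℕ.*_) (angle!-suc (n ∸ suc k)) ⟨
    angleFalling n k ℕ.* angle! (suc (n ∸ suc k))
      ≡⟨ cong (λ m → angleFalling n k ℕ.* angle! m) n∸k≡1+n∸[k+1] ⟨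
    angleFalling n k ℕ.* angle! (n ∸ k)
      ≡⟨ angleFalling*angle! k (ℕₚ.<⇒≤ k<n) ⟩
    angle! n ∎
    where
    open ≡-Reasoning
    n∸k≡1+n∸[k+1] : n ∸ k ≡ suc (n ∸ suc k)
    n∸k≡1+n∸[k+1] = ℕₚ.+-∸-assoc 1 k<n

module _ (d n : ℕ) where

  private
    D : ℕ → ℤ
    D k = detℕ d (hankelBinomᵀ n k)

  detℕ-hankelᵀ-recurrence : ∀ k → k < n → D (suc k) * + angle d (suc k) ≡ D k * + angle d (n ∸ k)
  detℕ-hankelᵀ-recurrence k k<n = ℤₚ.*-cancelˡ-≡ (+ (d !)) _ _ {{ℕₚ._!≢0 d}} (begin
    + (d !) * (D (suc k) * + angle d (suc k))    ≡⟨ rotate (+ (d !)) (D (suc k)) _ ⟩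
    + (d !) * + angle d (suc k) * D (suc k)      ≡⟨ cong (_* D (suc k)) (rising (suc k)) ⟨
    prodℤ d (λ i → + (suc k ℕ.+ i)) * D (suc k)  ≡⟨ detℕ-hankelᵀ-suc d n k k<n ⟩
    prodℤ d (λ j → + (n ∸ k ℕ.+ j)) * D k        ≡⟨ cong (_* D k) (rising (n ∸ k)) ⟩
    + (d !) * + angle d (n ∸ k) * D k            ≡⟨ rotate (+ (d !)) (D k) _ ⟨
    + (d !) * (D k * + angle d (n ∸ k))          ∎)
    where
    open ≡-Reasoning
    rotate : ∀ f x a → f * (x * a) ≡ f * a * x
    rotate = solve-∀
    rising : ∀ m → prodℤ d (λ i → + (m ℕ.+ i)) ≡ + (d !) * + angle d m
    rising m = trans (prodℤ-rising d m) (ℤₚ.pos-* (d !) (angle d m))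

  detℕ-hankelᵀ*angle! : ∀ k → k ≤ n → D k * + angle! d k ≡ + angleFalling d n k
  detℕ-hankelᵀ*angle! zero    _   = cong (_* + 1) (trans (sym (detℕ-toeplitz≡detℕ-hankelᵀ d n 0))
                                                          (detℕ-toeplitzBinom-0 d n))
  detℕ-hankelᵀ*angle! (suc k) k<n = begin
    D (suc k) * + angle! d (suc k)
      ≡⟨ cong (λ x → D (suc k) * + x) (angle!-suc d k) ⟩
    D (suc k) * + (angle d (suc k) ℕ.* angle! d k)
      ≡⟨ cong (D (suc k) *_) (ℤₚ.pos-* (angle d (suc k)) (angle! d k)) ⟩
    D (suc k) * (+ angle d (suc k) * + angle! d k)
      ≡⟨ ℤₚ.*-assoc (D (suc k)) _ _ ⟨
    D (suc k) * + angle d (suc k) * + angle! d k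
      ≡⟨ cong (_* + angle! d k) (detℕ-hankelᵀ-recurrence k k<n) ⟩
    D k * + angle d (n ∸ k) * + angle! d k
      ≡⟨ swap₂₃ (D k) _ _ ⟩
    D k * + angle! d k * + angle d (n ∸ k)
      ≡⟨ cong (_* + angle d (n ∸ k)) (detℕ-hankelᵀ*angle! k (ℕₚ.<⇒≤ k<n)) ⟩
    + angleFalling d n k * + angle d (n ∸ k)
      ≡⟨ ℤₚ.pos-* (angleFalling d n k) _ ⟨
    + angleFalling d n (suc k) ∎
    where
    open ≡-Reasoning
    swap₂₃ : ∀ x a b → x * a * b ≡ x * b * a
    swap₂₃ = solve-∀

  -- Both D k and D (n − k) times angle! k · angle! (n − k) equal angle! n.
  detℕ-hankelᵀ-sym : ∀ k → k ≤ n → D k ≡ D (n ∸ k)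
  detℕ-hankelᵀ-sym k k≤n = ℤₚ.*-cancelʳ-≡ (D k) (D (n ∸ k)) (+ a * + b) {{nonZero}} (begin
    D k * (+ a * + b)          ≡⟨ ℤₚ.*-assoc (D k) (+ a) (+ b) ⟨
    D k * + a * + b            ≡⟨ cong (_* + b) (detℕ-hankelᵀ*angle! k k≤n) ⟩
    + angleFalling d n k * + b ≡⟨ ℤₚ.pos-* (angleFalling d n k) b ⟨
    + (angleFalling d n k ℕ.* b)
                               ≡⟨ cong +_ (trans (angleFalling*angle! d k k≤n)
                                                 (sym (angleFalling*angle! d (n ∸ k) (ℕₚ.m∸n≤m n k)))) ⟩
    + (angleFalling d n (n ∸ k) ℕ.* angle! d (n ∸ (n ∸ k)))
                               ≡⟨ cong (λ m → + (angleFalling d n (n ∸ k) ℕ.* angle! d m)) (ℕₚ.m∸[m∸n]≡n k≤n) ⟩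
    + (angleFalling d n (n ∸ k) ℕ.* a)
                               ≡⟨ ℤₚ.pos-* (angleFalling d n (n ∸ k)) a ⟩
    + angleFalling d n (n ∸ k) * + a
                               ≡⟨ cong (_* + a) (detℕ-hankelᵀ*angle! (n ∸ k) (ℕₚ.m∸n≤m n k)) ⟨
    D (n ∸ k) * + b * + a      ≡⟨ swap (D (n ∸ k)) (+ a) (+ b) ⟩
    D (n ∸ k) * (+ a * + b)    ∎)
    where
    open ≡-Reasoning
    a = angle! d k
    b = angle! d (n ∸ k)
    nonZero = ℤₚ.i*j≢0 (+ a) (+ b) {{ℕ.>-nonZero (angle!>0 d k)}} {{ℕ.>-nonZero (angle!>0 d (n ∸ k))}}
    swap : ∀ x a b → x * b * a ≡ x * (a * b)
    swap = solve-∀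

hankelBinom : ℕ → ℕ → Matrix
hankelBinom n k i j = binomℤ (n ℕ.+ i ℕ.+ j) (+ (k ℕ.+ j))

hankelBinom≡hankelBinomᵀ : ∀ {n k} → k ≤ n → ∀ i j → hankelBinom n k i j ≡ hankelBinomᵀ n (n ∸ k) i j
hankelBinom≡hankelBinomᵀ {n} {k} k≤n i j = cong +_ (begin
  N C (k ℕ.+ j)
    ≡⟨ nCk≡nC[n∸k] (ℕₚ.+-mono-≤ (ℕₚ.≤-trans k≤n (ℕₚ.m≤m+n n i)) (ℕₚ.≤-refl {j})) ⟩
  N C (N ∸ (k ℕ.+ j))
    ≡⟨ cong (λ m → N C (m ∸ (k ℕ.+ j))) (ℕₚ.+-assoc n i j) ⟩
  N C (n ℕ.+ (i ℕ.+ j) ∸ (k ℕ.+ j))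
    ≡⟨ cong (λ m → N C (n ℕ.+ m ∸ (k ℕ.+ j))) (ℕₚ.+-comm i j) ⟩
  N C (n ℕ.+ (j ℕ.+ i) ∸ (k ℕ.+ j))
    ≡⟨ cong (λ m → N C (m ∸ (k ℕ.+ j))) (ℕₚ.+-assoc n j i) ⟨
  N C (n ℕ.+ j ℕ.+ i ∸ (k ℕ.+ j))
    ≡⟨ cong (N C_) ([n+i+j]∸[k+i]≡[n∸k]+j n k j i k≤n) ⟩
  N C (n ∸ k ℕ.+ i) ∎)
  where
  open ≡-Reasoning
  N = n ℕ.+ i ℕ.+ j

theorem2 : (d n k : ℕ) → 1 ≤ d → k ≤ n →
    (gbinom d n k ≡ det d (λ i j → binomℤ (n Data.Nat.+ toℕ i Data.Nat.+ toℕ j) (+ (k Data.Nat.+ toℕ j))) / 1)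
      × (gbinom d n k ≡ det d (λ i j → binomℤ n (+ (k Data.Nat.+ toℕ i) - + toℕ j)) / 1)
theorem2 d n k _ k≤n = gbinom≡ detA≡ , gbinom≡ detB≡
  where
  open ≡-Reasoning
  D : ℤ
  D = detℕ d (hankelBinomᵀ n k)
  gbinom≡ : ∀ {x} → x ≡ D → gbinom d n k ≡ x / 1
  gbinom≡ x≡D = trans
    (prodℚ-frac≡/1 k (λ j → angle d (n ∸ j)) (λ j → angle d (k ∸ j)) D
      (λ j j<k → angle>0 d (ℕₚ.m<n⇒0<n∸m j<k)) (detℕ-hankelᵀ*angle! d n k k≤n))
    (cong (_/ 1) (sym x≡D))
  detA≡ : det d (λ i j → hankelBinom n k (toℕ i) (toℕ j)) ≡ D
  detA≡ = begin
    det d (λ i j → hankelBinom n k (toℕ i) (toℕ j)) ≡⟨ det≡detℕ d (hankelBinom n k) ⟩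
    detℕ d (hankelBinom n k)                        ≡⟨ detℕ-cong d (hankelBinom≡hankelBinomᵀ k≤n) ⟩
    detℕ d (hankelBinomᵀ n (n ∸ k))                 ≡⟨ detℕ-hankelᵀ-sym d n k k≤n ⟨
    D ∎
  detB≡ : det d (λ i j → toeplitzBinom n k (toℕ i) (toℕ j)) ≡ D
  detB≡ = trans (det≡detℕ d (toeplitzBinom n k)) (detℕ-toeplitz≡detℕ-hankelᵀ d n k)
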